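{- Let $T$ be a Latin tableau whose shape $\lambda$ is squareable (no three rows and no three columns of $\lambda$ have the same length). Suppose that every vertex of the isotopy graph $G(T)$ has degree $d$, and that $T$ has no nontrivial symmetries except possibly those arising from symmetric pairs of columns. Then $G(T)$ is isomorphic to the $d$-dimensional cube, i.e. the graph on $\{0,1\}^d$ in which two $d$-tuples are adjacent iff they differ in exactly one coordinate.
   Context: A Latin tableau of shape $\lambda$ is a filling of the Young diagram of $\lambda$ (left-justified rows of lengths $\lambda_1\ge\lambda_2\ge\dots$, box $(i,j)$ in row $i$, column $j$) such that row $i$ contains each of $1,\dots,\lambda_i$ exactly once and no number repeats in a column. Elementary transformations: $r_{(i,j)}$ swaps two rows of equal length, $c_{(i,j)}$ swaps two columns of equal length, $s_{(x,y)}$ interchanges entries $x,y$ everywhere (allowed when they occur equally often). The isotopy group of $\lambda$ is the group generated by these transformations (product of symmetric groups permuting equal-length rows, equal-length columns, and equally frequent entries); the isotopy graph $G(T)$ has vertices the tableaux obtained from $T$ by this group, adjacent when related by one elementary transformation. A symmetry of $T$ is an element of the isotopy group fixing $T$. Two columns $i,j$ form a symmetric pair if either (1) row 1 has length $n$, row 2 has length $m<n$, $i,j>m$, and boxes $(1,i),(1,j)$ contain entries $x,y\in\{m+1,\dots,n\}$; or (2) row 2 has length $n$, row 3 has length $m<n$, $m<i,j\le n$, and the boxes in rows $1,2$, columns $i,j$ read $x,y$ / $y,x$ with $\{x,y\}\subseteq\{m+1,\dots,n\}$. Such a pair gives the nontrivial symmetry $s_{(x,y)}c_{(i,j)}$;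 a symmetry arises from symmetric pairs of columns if it is a composition of symmetries of this form. -}

module Defs where

open import Data.Nat using (ℕ; zero; suc; _+_; _≤_; _<_; _≥_; _<?_)
open import Data.Nat.Properties using (≤-refl)
open import Data.Bool using (Bool)
open import Data.Fin using (Fin; toℕ; fromℕ<)
open import Data.Fin.Permutation using (Permutation′; _⟨$⟩ʳ_; _⟨$⟩ˡ_; transpose; _∘ₚ_)
import Data.Fin.Permutation as P
open import Data.List using (List; []; _∷_; length; map; upTo; lookup)
open import Data.List.Relation.Unary.Linked using (Linked)
open import Data.List.Relation.Unary.All using (All)
open import Data.List.Relation.Unary.Unique.Propositional using (Unique)
open import Data.List.Relation.Binary.Permutation.Propositional using (_↭_)
open import Data.List.Membership.Propositional using (_∈_)
open import Data.Vec using (Vec)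
import Data.Vec as V
open import Data.Product using (Σ; ∃; _×_; _,_)
open import Function.Bundles using (_⇔_)
open import Function.Definitions using (Injective)
open import Relation.Binary.PropositionalEquality using (_≡_; _≢_)
open import Relation.Nullary using (¬_; yes; no)

-- All indices are 0-based: row i, column j, entries 0 … λᵢ-1
-- (the paper's entry k corresponds to k-1 here).

Tableau : Set
Tableau = List (List ℕ)

Shape : Set
Shape = List ℕ

IsPartition : Shape → Set
IsPartition sh = Linked _≥_ sh × All (λ k → 1 ≤ k) sh

at : {A : Set} → A → List A → ℕ → A
at d []       _       = d
at d (x ∷ xs) zero    = x
at d (x ∷ xs) (suc n) = at d xs n

nRows : Shape → ℕ
nRows = length

rowLen : Shape → ℕ → ℕ
rowLen sh i = at 0 sh i

nCols : Shape → ℕ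
nCols sh = rowLen sh 0

colLenAux : List ℕ → ℕ → ℕ
colLenAux []       j = 0
colLenAux (l ∷ ls) j with j <? l
... | yes _ = suc (colLenAux ls j)
... | no  _ = colLenAux ls j

colLen : Shape → ℕ → ℕ
colLen = colLenAux

-- In a Latin tableau of shape sh, entry x occurs exactly once in every row
-- of length > x, so its frequency is the number of such rows.
entryFreq : Shape → ℕ → ℕ
entryFreq = colLenAux

entry : Tableau → ℕ → ℕ → ℕ
entry T i j = at 0 (at [] T i) j

Squareable : Shape → Set
Squareable sh =
  (∀ (i j k : Fin (nRows sh)) → i ≢ j → j ≢ k → i ≢ k →
     ¬ (rowLen sh (toℕ i) ≡ rowLen sh (toℕ j) × rowLen sh (toℕ j) ≡ rowLen sh (toℕ k)))
  × (∀ (i j k : Fin (nCols sh)) → i ≢ j → j ≢ k → i ≢ k →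
     ¬ (colLen sh (toℕ i) ≡ colLen sh (toℕ j) × colLen sh (toℕ j) ≡ colLen sh (toℕ k)))

IsLatin : Shape → Tableau → Set
IsLatin sh T =
  map length T ≡ sh
  × (∀ i → i < nRows sh → at [] T i ↭ upTo (rowLen sh i))
  × (∀ i i' j → i ≢ i' → j < rowLen sh i → j < rowLen sh i' → entry T i j ≢ entry T i' j)

app : {n : ℕ} → Permutation′ n → ℕ → ℕ
app {n} p k with k <? n
... | yes k<n = toℕ (p ⟨$⟩ʳ fromℕ< k<n)
... | no  _   = k

record Iso (sh : Shape) : Set where
  constructor iso
  field
    σ : Permutation′ (nRows sh)
    τ : Permutation′ (nCols sh)
    π : Permutation′ (nCols sh)
open Iso public

InIsoGroup : (sh : Shape) → Iso sh → Set
InIsoGroup sh g =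
  (∀ i → rowLen sh (toℕ (σ g ⟨$⟩ʳ i)) ≡ rowLen sh (toℕ i))
  × (∀ j → colLen sh (toℕ (τ g ⟨$⟩ʳ j)) ≡ colLen sh (toℕ j))
  × (∀ x → entryFreq sh (toℕ (π g ⟨$⟩ʳ x)) ≡ entryFreq sh (toℕ x))

appInv : {n : ℕ} → Permutation′ n → ℕ → ℕ
appInv p = app (P.flip p)

-- action: (g · T) (σ i , τ j) = π (T (i , j))
act : (sh : Shape) → Iso sh → Tableau → Tableau
act sh g T =
  map (λ i' → map (λ j' → app (π g) (entry T (appInv (σ g) i') (appInv (τ g) j')))
                  (upTo (rowLen sh i')))
      (upTo (nRows sh))

idIso : (sh : Shape) → Iso sh
idIso sh = iso P.id P.id P.id

_⊙_ : {sh : Shape} → Iso sh → Iso sh → Iso sh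
g ⊙ h = iso (σ g ∘ₚ σ h) (τ g ∘ₚ τ h) (π g ∘ₚ π h)

_≈ᵢ_ : {sh : Shape} → Iso sh → Iso sh → Set
g ≈ᵢ h = (∀ i → σ g ⟨$⟩ʳ i ≡ σ h ⟨$⟩ʳ i)
       × (∀ j → τ g ⟨$⟩ʳ j ≡ τ h ⟨$⟩ʳ j)
       × (∀ x → π g ⟨$⟩ʳ x ≡ π h ⟨$⟩ʳ x)

IsSymmetry : (sh : Shape) → Tableau → Iso sh → Set
IsSymmetry sh T g = InIsoGroup sh g × act sh g T ≡ T

Nontrivial : (sh : Shape) → Iso sh → Set
Nontrivial sh g = ¬ (g ≈ᵢ idIso sh)

data Elementary (sh : Shape) : Iso sh → Set where
  rowSwap : (i j : Fin (nRows sh)) → i ≢ j → rowLen sh (toℕ i) ≡ rowLen sh (toℕ j) →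
            Elementary sh (iso (transpose i j) P.id P.id)
  colSwap : (i j : Fin (nCols sh)) → i ≢ j → colLen sh (toℕ i) ≡ colLen sh (toℕ j) →
            Elementary sh (iso P.id (transpose i j) P.id)
  entSwap : (x y : Fin (nCols sh)) → x ≢ y → entryFreq sh (toℕ x) ≡ entryFreq sh (toℕ y) →
            Elementary sh (iso P.id P.id (transpose x y))

InOrbit : Shape → Tableau → Tableau → Set
InOrbit sh T V = Σ (Iso sh) λ g → InIsoGroup sh g × act sh g T ≡ V

Adj : Shape → Tableau → Tableau → Set
Adj sh V W = V ≢ W × Σ (Iso sh) λ e → Elementary sh e × act sh e V ≡ W

HasDegree : Shape → Tableau → ℕ → Set
HasDegree sh V d =
  Σ (List Tableau) λ ns → Unique ns × (∀ W → (W ∈ ns ⇔ Adj sh V W)) × length ns ≡ d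

-- symmetric pairs of columns (0-based version of the paper's definition),
-- together with the entries x , y they carry.
-- Rows beyond the last one have length 0.
data SymPair (sh : Shape) (T : Tableau) : (i j x y : Fin (nCols sh)) → Set where
  type1 : ∀ {i j x y} → i ≢ j →
          let n = rowLen sh 0 ; m = rowLen sh 1 in
          m < n → m ≤ toℕ i → m ≤ toℕ j →
          entry T 0 (toℕ i) ≡ toℕ x → entry T 0 (toℕ j) ≡ toℕ y →
          m ≤ toℕ x → toℕ x < n → m ≤ toℕ y → toℕ y < n →
          SymPair sh T i j x y
  type2 : ∀ {i j x y} → i ≢ j →
          let n = rowLen sh 1 ; m = rowLen sh 2 in
          m < n → m ≤ toℕ i → toℕ i < n → m ≤ toℕ j → toℕ j < n →
          entry T 0 (toℕ i) ≡ toℕ x → entry T 0 (toℕ j) ≡ toℕ y →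
          entry T 1 (toℕ i) ≡ toℕ y → entry T 1 (toℕ j) ≡ toℕ x →
          m ≤ toℕ x → toℕ x < n → m ≤ toℕ y → toℕ y < n →
          SymPair sh T i j x y

symPairIso : (sh : Shape) → (i j x y : Fin (nCols sh)) → Iso sh
symPairIso sh i j x y = iso P.id (transpose i j) (transpose x y)

data Composite (sh : Shape) (T : Tableau) : Iso sh → Set where
  none : Composite sh T (idIso sh)
  more : ∀ {g} (i j x y : Fin (nCols sh)) → SymPair sh T i j x y →
         Composite sh T g → Composite sh T (symPairIso sh i j x y ⊙ g)

ArisesFromSymPairs : (sh : Shape) → Tableau → Iso sh → Set
ArisesFromSymPairs sh T g = Σ (Iso sh) λ h → Composite sh T h × g ≈ᵢ h

CubeAdj : {d : ℕ} → Vec Bool d → Vec Bool d → Set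
CubeAdj {d} u v = Σ (Fin d) λ k → V.lookup u k ≢ V.lookup v k
                    × (∀ k' → k' ≢ k → V.lookup u k' ≡ V.lookup v k')

IsoToCube : Shape → Tableau → ℕ → Set
IsoToCube sh T d =
  Σ (Vec Bool d → Tableau) λ f →
    Injective _≡_ _≡_ f
    × (∀ u → InOrbit sh T (f u))
    × (∀ V → InOrbit sh T V → Σ (Vec Bool d) λ u → f u ≡ V)
    × (∀ u v → (Adj sh (f u) (f v) ⇔ CubeAdj u v))

-- Squareability makes every label class (rows, columns or symbols of equal length, resp. frequency)
-- have at most two members, so the isotopy group consists of commuting involutions: it is an
-- elementary abelian 2-group generated by the elementary transformations. If e₁ … e_d are
-- elementary transformations taking T to its d neighbours, u ↦ (∏_{uₗ = 1} eₗ) · T is onto the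
-- orbit, and each elementary transformation either fixes such a vertex or flips one coordinate.
-- For injectivity fix a tableau W and let χ_W(g) be the parity of the number of 2-cycles of g
-- whose transposition takes T to W. This is a homomorphism to ℤ/2; it vanishes on s_(x,y) c_(i,j)
-- for a symmetric pair, because c_(i,j) · T = s_(x,y) · T, hence by hypothesis on all symmetries,
-- hence it is constant on the fibres of g ↦ g · T; and χ at the l-th neighbour reads off uₗ.

module Submission where

open import Defs

open import Algebra.Bundles using (CommutativeMonoid; CommutativeRing)
open import Data.Bool using (Bool; true; false; _xor_; _∧_; not)
open import Data.Bool.Properties
  using (xor-∧-commutativeRing; xor-same; xor-assoc; xor-identityʳ; ∧-distribʳ-xor; T-≡; ¬-not; not-¬)
open import Data.Empty using (⊥-elim)
open import Data.Fin using (Fin; zero; suc; toℕ; fromℕ<; punchIn; _≟_; _<?_) renaming (_<_ to _<ᶠ_)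
open import Data.Fin.Properties using (toℕ-injective; toℕ<n; toℕ-fromℕ<; fromℕ<-toℕ; punchInᵢ≢i)
open import Data.Fin.Permutation using (Permutation′; _⟨$⟩ʳ_; _⟨$⟩ˡ_; transpose; _∘ₚ_)
import Data.Fin.Permutation as P
import Data.Fin.Permutation.Components as PC
open import Data.List using (List; []; _∷_; length; map; upTo; applyUpTo; cartesianProduct; allFin)
import Data.List as L
open import Data.List.Properties using (map-upTo; map-cong; map-cong-local; length-map; ≡-dec)
open import Data.List.Membership.Propositional using (_∈_)
open import Data.List.Membership.Propositional.Properties
  using (∈-cartesianProduct⁺; ∈-allFin; ∈-upTo⁻; ∈-lookup)
open import Data.List.Relation.Binary.Permutation.Propositional using (_↭_; ↭-sym; ↭⇒↭ₛ)
open import Data.List.Relation.Binary.Permutation.Propositional.Properties using (∈-resp-↭)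
import Data.List.Relation.Binary.Permutation.Setoid.Properties as ↭ₛ
open import Data.List.Relation.Unary.All as All using (All; []; _∷_)
open import Data.List.Relation.Unary.All.Properties using (applyUpTo⁺₁; map⁻)
open import Data.List.Relation.Unary.AllPairs using (_∷_)
open import Data.List.Relation.Unary.Any using (here; there)
import Data.List.Relation.Unary.Any as Any
import Data.List.Relation.Unary.Any.Properties as Any
open import Data.List.Relation.Unary.Linked using (Linked; [-]; _∷_)
import Data.List.Relation.Unary.Linked as Linked
open import Data.List.Relation.Unary.Unique.Propositional using (Unique)
open import Data.List.Relation.Unary.Unique.Propositional.Properties using (upTo⁺)
open import Data.Nat using (ℕ; zero; suc; _<ᵇ_; _<_; _≤_; _≥_; z≤n; s≤s)
import Data.Nat.Properties as ℕ
open import Data.Product using (∃-syntax; _×_; _,_; proj₁; proj₂)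
open import Data.Sum using (_⊎_; inj₁; inj₂; [_,_]′)
open import Data.Vec using (Vec; []; _∷_)
import Data.Vec as V
open import Data.Vec.Properties using (tabulate∘lookup; tabulate-cong; lookup∘updateAt; lookup∘updateAt′)
open import Function using (_∘_; case_of_)
open import Function.Bundles using (Injection; Equivalence; mk⇔)
open import Function.Properties.Inverse using (↔⇒↣)
open import Relation.Binary.PropositionalEquality
open import Relation.Nullary using (¬_; Dec; yes; no; does)
open import Relation.Nullary.Decidable using (dec-true; dec-false; decidable-stable)
open import Relation.Nullary.Reflects using (ofʸ)

xorCommutativeMonoid : CommutativeMonoid _ _
xorCommutativeMonoid = CommutativeRing.+-commutativeMonoid xor-∧-commutativeRing

open import Algebra.Properties.CommutativeMonoid.Sum xorCommutativeMonoid
  using (sum; sum-remove; ∑-distrib-+; sum-cong-≗; sum-replicate-zero)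
open import Algebra.Properties.CommutativeSemigroup
  (CommutativeMonoid.commutativeSemigroup xorCommutativeMonoid) using (interchange)

true≢false : true ≢ false
true≢false ()

sum-false : ∀ {n} (f : Fin n → Bool) → (∀ i → f i ≡ false) → sum f ≡ false
sum-false {n} f f≡false = trans (sum-cong-≗ f≡false) (sum-replicate-zero n)

sum-single : ∀ {n} (f : Fin n → Bool) (a : Fin n) → (∀ i → f i ≡ true → i ≡ a) → sum f ≡ f a
sum-single {suc n} f a only-a =
  trans (sum-remove {i = a} f)
        (trans (cong (f a xor_) (sum-false _ λ i → false-unless-a (punchIn a i) (punchInᵢ≢i a i)))
               (xor-identityʳ (f a)))
  where
  false-unless-a : ∀ i → i ≢ a → f i ≡ false
  false-unless-a i i≢a with f i in fi
  ... | false = refl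
  ... | true  = ⊥-elim (i≢a (only-a i fi))

xor-cancelʳ : ∀ x y → x xor y ≡ false → x ≡ y
xor-cancelʳ x y x⊕y≡false = begin
  x                   ≡⟨ sym (xor-identityʳ x) ⟩
  x xor false         ≡⟨ cong (x xor_) (sym (xor-same y)) ⟩
  x xor (y xor y)     ≡⟨ sym (xor-assoc x y y) ⟩
  (x xor y) xor y     ≡⟨ cong (_xor y) x⊕y≡false ⟩
  y                   ∎
  where open ≡-Reasoning

lookup-ext : ∀ {A : Set} {d} (u v : Vec A d) → (∀ l → V.lookup u l ≡ V.lookup v l) → u ≡ v
lookup-ext u v u≗v = trans (sym (tabulate∘lookup u)) (trans (tabulate-cong u≗v) (tabulate∘lookup v))

module _ {n : ℕ} where

  permutation-injective : (p : Permutation′ n) {a b : Fin n} → p ⟨$⟩ʳ a ≡ p ⟨$⟩ʳ b → a ≡ b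
  permutation-injective p = Injection.injective (↔⇒↣ p)

  transpose-applyˡ : (i j : Fin n) → transpose i j ⟨$⟩ʳ i ≡ j
  transpose-applyˡ i j rewrite dec-true (i ≟ i) refl = refl

  transpose-applyʳ : (i j : Fin n) → transpose i j ⟨$⟩ʳ j ≡ i
  transpose-applyʳ i j with j ≟ i
  ... | yes j≡i = j≡i
  ... | no _ rewrite dec-true (j ≟ j) refl = refl

  transpose-apply-≢ : (i j k : Fin n) → k ≢ i → k ≢ j → transpose i j ⟨$⟩ʳ k ≡ k
  transpose-apply-≢ i j k k≢i k≢j rewrite dec-false (k ≟ i) k≢i | dec-false (k ≟ j) k≢j = refl

  data TransposeView (i j k : Fin n) : Set where
    at-i     : k ≡ i → transpose i j ⟨$⟩ʳ k ≡ j → TransposeView i j k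
    at-j     : k ≡ j → transpose i j ⟨$⟩ʳ k ≡ i → TransposeView i j k
    elsewhere : k ≢ i → k ≢ j → transpose i j ⟨$⟩ʳ k ≡ k → TransposeView i j k

  transpose-view : (i j k : Fin n) → TransposeView i j k
  transpose-view i j k with k ≟ i | k ≟ j
  ... | yes refl | _        = at-i refl (transpose-applyˡ i j)
  ... | no _     | yes refl = at-j refl (transpose-applyʳ i j)
  ... | no k≢i   | no k≢j   = elsewhere k≢i k≢j (transpose-apply-≢ i j k k≢i k≢j)

  transpose-comm : (i j : Fin n) → transpose j i P.≈ transpose i j
  transpose-comm i j k with transpose-view i j k
  ... | at-i refl t        = trans (transpose-applyʳ j k) (sym t)
  ... | at-j refl t        = trans (transpose-applyˡ k i) (sym t)
  ... | elsewhere k≢i k≢j t = trans (transpose-apply-≢ j i k k≢j k≢i) (sym t)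

  transpose-involutive : (i j k : Fin n) → transpose i j ⟨$⟩ʳ (transpose i j ⟨$⟩ʳ k) ≡ k
  transpose-involutive i j k =
    trans (cong (transpose i j ⟨$⟩ʳ_) (sym (transpose-comm i j k))) (PC.transpose-inverse i j)

  ≢∧≮⇒> : {i j : Fin n} → i ≢ j → ¬ i <ᶠ j → j <ᶠ i
  ≢∧≮⇒> i≢j i≮j = ℕ.≤∧≢⇒< (ℕ.≮⇒≥ i≮j) (λ j≡i → i≢j (toℕ-injective (sym j≡i)))

  app-< : (p : Permutation′ n) {k : ℕ} (k<n : k < n) → app p k ≡ toℕ (p ⟨$⟩ʳ fromℕ< k<n)
  app-< p {k} k<n with k ℕ.<? n
  ... | yes _   = refl
  ... | no k≮n  = ⊥-elim (k≮n k<n)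

  app-≮ : (p : Permutation′ n) {k : ℕ} → ¬ k < n → app p k ≡ k
  app-≮ p {k} k≮n with k ℕ.<? n
  ... | yes k<n = ⊥-elim (k≮n k<n)
  ... | no _    = refl

  app-toℕ : (p : Permutation′ n) (i : Fin n) → app p (toℕ i) ≡ toℕ (p ⟨$⟩ʳ i)
  app-toℕ p i = trans (app-< p (toℕ<n i)) (cong (λ j → toℕ (p ⟨$⟩ʳ j)) (fromℕ<-toℕ i (toℕ<n i)))

  app-id : (k : ℕ) → app (P.id {n}) k ≡ k
  app-id k with k ℕ.<? n
  ... | yes k<n = toℕ-fromℕ< k<n
  ... | no _    = refl

  app-∘ : (p q : Permutation′ n) (k : ℕ) → app (p ∘ₚ q) k ≡ app q (app p k)
  app-∘ p q k with k ℕ.<? n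
  ... | yes k<n = sym (app-toℕ q (p ⟨$⟩ʳ fromℕ< k<n))
  ... | no k≮n  = sym (app-≮ q k≮n)

  app-cong : {p q : Permutation′ n} → p P.≈ q → (k : ℕ) → app p k ≡ app q k
  app-cong p≈q k with k ℕ.<? n
  ... | yes _ = cong toℕ (p≈q _)
  ... | no _  = refl

  app-bounded : (p : Permutation′ n) {k : ℕ} → k < n → app p k < n
  app-bounded p k<n rewrite app-< p k<n = toℕ<n _

  flip-cong : {p q : Permutation′ n} → p P.≈ q → P.flip p P.≈ P.flip q
  flip-cong {p} {q} p≈q i = permutation-injective p (trans (P.inverseʳ p) (sym (trans (p≈q _) (P.inverseʳ q))))

  appInv-preserving : (label : ℕ → ℕ) (p : Permutation′ n) → (∀ i → label (toℕ (p ⟨$⟩ʳ i)) ≡ label (toℕ i)) →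
                      (k : ℕ) → label (appInv p k) ≡ label k
  appInv-preserving label p p-pres k with k ℕ.<? n
  ... | no _    = refl
  ... | yes k<n = begin
    label (toℕ (P.flip p ⟨$⟩ʳ fromℕ< k<n))                 ≡⟨ sym (p-pres _) ⟩
    label (toℕ (p ⟨$⟩ʳ (p ⟨$⟩ˡ fromℕ< k<n)))                ≡⟨ cong (label ∘ toℕ) (P.inverseʳ p) ⟩
    label (toℕ (fromℕ< k<n))                               ≡⟨ cong label (toℕ-fromℕ< k<n) ⟩
    label k                                                ∎
    where open ≡-Reasoning

  appInv-id : (k : ℕ) → appInv (P.id {n}) k ≡ k
  appInv-id k = trans (app-cong {P.flip P.id} {P.id} (λ _ → refl) k) (app-id k)

module _ {n : ℕ} (x y : Fin n) where

  app-transposeˡ : app (transpose x y) (toℕ x) ≡ toℕ y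
  app-transposeˡ = trans (app-toℕ (transpose x y) x) (cong toℕ (transpose-applyˡ x y))

  app-transposeʳ : app (transpose x y) (toℕ y) ≡ toℕ x
  app-transposeʳ = trans (app-toℕ (transpose x y) y) (cong toℕ (transpose-applyʳ x y))

  app-transpose-≢ : ∀ {k} → k ≢ toℕ x → k ≢ toℕ y → app (transpose x y) k ≡ k
  app-transpose-≢ {k} k≢x k≢y with k ℕ.<? n
  ... | no _    = refl
  ... | yes k<n = trans (cong toℕ (transpose-apply-≢ x y _ (k≢ (toℕ-fromℕ< k<n) k≢x) (k≢ (toℕ-fromℕ< k<n) k≢y)))
                        (toℕ-fromℕ< k<n)
    where
    k≢ : ∀ {K : Fin n} {z} → toℕ K ≡ k → k ≢ toℕ z → K ≢ z
    k≢ K≡k k≢z refl = k≢z (sym K≡k)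

-- Permutations preserving a labelling whose fibres have at most two elements

module AtMostTwoPerLabel {n : ℕ} (label : Fin n → ℕ)
  (no-three : ∀ (i j k : Fin n) → i ≢ j → j ≢ k → i ≢ k → ¬ (label i ≡ label j × label j ≡ label k))
  where

  Preserving : Permutation′ n → Set
  Preserving p = ∀ i → label (p ⟨$⟩ʳ i) ≡ label i

  ∘-preserving : ∀ p q → Preserving p → Preserving q → Preserving (p ∘ₚ q)
  ∘-preserving p q p-pres q-pres i = trans (q-pres _) (p-pres i)

  transpose-preserving : ∀ i j → label i ≡ label j → Preserving (transpose i j)
  transpose-preserving i j i~j k with transpose-view i j k
  ... | at-i refl t       = trans (cong label t) (sym i~j)
  ... | at-j refl t       = trans (cong label t) i~j
  ... | elsewhere _ _ t   = cong label t

  module _ (p : Permutation′ n) (p-pres : Preserving p) where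

    image-in-pair : ∀ {i j} → i ≢ j → label i ≡ label j → p ⟨$⟩ʳ i ≡ i ⊎ p ⟨$⟩ʳ i ≡ j
    image-in-pair {i} {j} i≢j i~j with p ⟨$⟩ʳ i ≟ i | p ⟨$⟩ʳ i ≟ j
    ... | yes pi≡i | _        = inj₁ pi≡i
    ... | no _     | yes pi≡j = inj₂ pi≡j
    ... | no pi≢i  | no pi≢j  =
      ⊥-elim (no-three i j (p ⟨$⟩ʳ i) i≢j (λ e → pi≢j (sym e)) (λ e → pi≢i (sym e))
                       (i~j , trans (sym i~j) (sym (p-pres i))))

    partner-fixed : ∀ {i j} → i ≢ j → label i ≡ label j → p ⟨$⟩ʳ i ≡ i → p ⟨$⟩ʳ j ≡ j
    partner-fixed i≢j i~j pi≡i with image-in-pair (λ j≡i → i≢j (sym j≡i)) (sym i~j)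
    ... | inj₁ pj≡j = pj≡j
    ... | inj₂ pj≡i = ⊥-elim (i≢j (permutation-injective p (trans pi≡i (sym pj≡i))))

    partner-swapped : ∀ {i j} → i ≢ j → label i ≡ label j → p ⟨$⟩ʳ i ≡ j → p ⟨$⟩ʳ j ≡ i
    partner-swapped i≢j i~j pi≡j with image-in-pair (λ j≡i → i≢j (sym j≡i)) (sym i~j)
    ... | inj₁ pj≡j = ⊥-elim (i≢j (permutation-injective p (trans pi≡j (sym pj≡j))))
    ... | inj₂ pj≡i = pj≡i

    preserving-involutive : ∀ k → p ⟨$⟩ʳ (p ⟨$⟩ʳ k) ≡ k
    preserving-involutive k with p ⟨$⟩ʳ k ≟ k
    ... | yes pk≡k = trans (cong (p ⟨$⟩ʳ_) pk≡k) pk≡k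
    ... | no pk≢k  = partner-swapped (λ k≡pk → pk≢k (sym k≡pk)) (sym (p-pres k)) refl

  preserving-comm : ∀ p q → Preserving p → Preserving q → ∀ k → p ⟨$⟩ʳ (q ⟨$⟩ʳ k) ≡ q ⟨$⟩ʳ (p ⟨$⟩ʳ k)
  preserving-comm p q p-pres q-pres k with q ⟨$⟩ʳ k ≟ k | p ⟨$⟩ʳ k ≟ k
  ... | yes qk≡k | yes pk≡k =
    trans (cong (p ⟨$⟩ʳ_) qk≡k) (trans pk≡k (trans (sym qk≡k) (cong (q ⟨$⟩ʳ_) (sym pk≡k))))
  ... | yes qk≡k | no pk≢k =
    trans (cong (p ⟨$⟩ʳ_) qk≡k) (sym (partner-fixed q q-pres (λ e → pk≢k (sym e)) (sym (p-pres k)) qk≡k))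
  ... | no qk≢k | yes pk≡k =
    trans (partner-fixed p p-pres (λ e → qk≢k (sym e)) (sym (q-pres k)) pk≡k) (cong (q ⟨$⟩ʳ_) (sym pk≡k))
  ... | no qk≢k | no pk≢k with image-in-pair p p-pres (λ e → qk≢k (sym e)) (sym (q-pres k))
  ...   | inj₁ pk≡k  = ⊥-elim (pk≢k pk≡k)
  ...   | inj₂ pk≡qk =
    trans (partner-swapped p p-pres (λ k≡qk → qk≢k (sym k≡qk)) (sym (q-pres k)) pk≡qk)
          (sym (trans (cong (q ⟨$⟩ʳ_) pk≡qk) (preserving-involutive q q-pres k)))

  <⇒<ᵇ≡true : ∀ {i j : Fin n} → i <ᶠ j → (toℕ i <ᵇ toℕ j) ≡ true
  <⇒<ᵇ≡true i<j = Equivalence.to T-≡ (ℕ.<⇒<ᵇ i<j)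

  -- for a preserving p (an involution) moves p i j says that {i , j}, i < j, is a 2-cycle of p;
  -- these flags add up mod 2 under composition
  moves : Permutation′ n → Fin n → Fin n → Bool
  moves p i j = (toℕ i <ᵇ toℕ j) ∧ does (p ⟨$⟩ʳ i ≟ j)

  moves-cong : ∀ p q → p P.≈ q → ∀ i j → moves p i j ≡ moves q i j
  moves-cong p q p≈q i j = cong (λ k → (toℕ i <ᵇ toℕ j) ∧ does (k ≟ j)) (p≈q i)

  moves-id : ∀ i j → moves P.id i j ≡ false
  moves-id i j with toℕ i <ᵇ toℕ j | ℕ.<ᵇ-reflects-< (toℕ i) (toℕ j)
  ... | false | _       = refl
  ... | true  | ofʸ i<j = dec-false (i ≟ j) (λ { refl → ℕ.<-irrefl refl i<j })

  moves⇒swappable : ∀ p → Preserving p → ∀ i j → moves p i j ≡ true → i ≢ j × label i ≡ label j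
  moves⇒swappable p p-pres i j moving
    with toℕ i <ᵇ toℕ j | ℕ.<ᵇ-reflects-< (toℕ i) (toℕ j) | p ⟨$⟩ʳ i ≟ j
  ... | true | ofʸ i<j | yes pi≡j = (λ { refl → ℕ.<-irrefl refl i<j }) , trans (sym (p-pres i)) (cong label pi≡j)

  private
    moves-pair : ∀ p q → Preserving p → Preserving q → ∀ {i j} → i ≢ j →
      does (q ⟨$⟩ʳ (p ⟨$⟩ʳ i) ≟ j) ≡ does (p ⟨$⟩ʳ i ≟ j) xor does (q ⟨$⟩ʳ i ≟ j)
    moves-pair p q p-pres q-pres {i} {j} i≢j with label i ℕ.≟ label j
    ... | no i≁j = trans (dec-false (_ ≟ j) (off (∘-preserving p q p-pres q-pres i)))
                         (sym (cong₂ _xor_ (dec-false (_ ≟ j) (off (p-pres i))) (dec-false (_ ≟ j) (off (q-pres i)))))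
      where
      off : ∀ {k} → label k ≡ label i → k ≢ j
      off k~i refl = i≁j (sym k~i)
    ... | yes i~j with image-in-pair p p-pres i≢j i~j
    ...   | inj₁ pi≡i rewrite pi≡i | dec-false (i ≟ j) i≢j = refl
    ...   | inj₂ pi≡j rewrite pi≡j with image-in-pair q q-pres i≢j i~j
    ...     | inj₁ qi≡i rewrite partner-fixed q q-pres i≢j i~j qi≡i | qi≡i
                              | dec-true (j ≟ j) refl | dec-false (i ≟ j) i≢j = refl
    ...     | inj₂ qi≡j rewrite partner-swapped q q-pres i≢j i~j qi≡j | qi≡j
                              | dec-true (j ≟ j) refl | dec-false (i ≟ j) i≢j = refl

  moves-∘ : ∀ p q → Preserving p → Preserving q → ∀ i j → moves (p ∘ₚ q) i j ≡ moves p i j xor moves q i j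
  moves-∘ p q p-pres q-pres i j with toℕ i <ᵇ toℕ j | ℕ.<ᵇ-reflects-< (toℕ i) (toℕ j)
  ... | false | _       = refl
  ... | true  | ofʸ i<j = moves-pair p q p-pres q-pres (λ { refl → ℕ.<-irrefl refl i<j })

  moves-transpose-only : ∀ a b → a <ᶠ b → ∀ i j → moves (transpose a b) i j ≡ true → i ≡ a × j ≡ b
  moves-transpose-only a b a<b i j moving
    with toℕ i <ᵇ toℕ j | ℕ.<ᵇ-reflects-< (toℕ i) (toℕ j) | transpose a b ⟨$⟩ʳ i ≟ j | transpose-view a b i
  ... | true | ofʸ i<j | yes ti≡j | at-i i≡a ti≡b = i≡a , trans (sym ti≡j) ti≡b
  ... | true | ofʸ i<j | yes ti≡j | at-j refl ti≡a =
    ⊥-elim (ℕ.<-asym a<b (subst (i <ᶠ_) (trans (sym ti≡j) ti≡a) i<j))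
  ... | true | ofʸ i<j | yes ti≡j | elsewhere _ _ ti≡i =
    ⊥-elim (ℕ.<-irrefl (cong toℕ (trans (sym ti≡i) ti≡j)) i<j)

  moves-transpose-self : ∀ a b → a <ᶠ b → moves (transpose a b) a b ≡ true
  moves-transpose-self a b a<b rewrite <⇒<ᵇ≡true a<b = dec-true (_ ≟ b) (transpose-applyˡ a b)

  unmoved⇒id : ∀ p → Preserving p → (∀ i j → moves p i j ≡ false) → p P.≈ P.id
  unmoved⇒id p p-pres unmoved i with p ⟨$⟩ʳ i ≟ i
  ... | yes pi≡i = pi≡i
  ... | no pi≢i with i <? p ⟨$⟩ʳ i
  ...   | yes i<pi with unmoved i (p ⟨$⟩ʳ i)
  ...     | moving rewrite <⇒<ᵇ≡true i<pi | dec-true (p ⟨$⟩ʳ i ≟ p ⟨$⟩ʳ i) refl = ⊥-elim (true≢false moving)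
  unmoved⇒id p p-pres unmoved i | no pi≢i | no i≮pi
    with unmoved (p ⟨$⟩ʳ i) i | ≢∧≮⇒> (λ e → pi≢i (sym e)) i≮pi
  ...   | moving | pi<i
    rewrite <⇒<ᵇ≡true pi<i
          | dec-true (p ⟨$⟩ʳ (p ⟨$⟩ʳ i) ≟ i) (preserving-involutive p p-pres i) = ⊥-elim (true≢false moving)

  moves⇒< : ∀ p i j → moves p i j ≡ true → i <ᶠ j
  moves⇒< p i j moving with toℕ i <ᵇ toℕ j | ℕ.<ᵇ-reflects-< (toℕ i) (toℕ j)
  ... | true | ofʸ i<j = i<j

  movesParity : (Fin n → Fin n → Bool) → Permutation′ n → Bool
  movesParity w p = sum λ i → sum λ j → moves p i j ∧ w i j

  module _ (w : Fin n → Fin n → Bool) where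

    movesParity-cong : ∀ p q → p P.≈ q → movesParity w p ≡ movesParity w q
    movesParity-cong p q p≈q = sum-cong-≗ λ i → sum-cong-≗ λ j → cong (_∧ w i j) (moves-cong p q p≈q i j)

    movesParity-id : movesParity w P.id ≡ false
    movesParity-id = sum-false _ λ i → sum-false _ λ j → cong (_∧ w i j) (moves-id i j)

    movesParity-∘ : ∀ p q → Preserving p → Preserving q →
                    movesParity w (p ∘ₚ q) ≡ movesParity w p xor movesParity w q
    movesParity-∘ p q p-pres q-pres = begin
      sum (λ i → sum λ j → moves (p ∘ₚ q) i j ∧ w i j)
        ≡⟨ sum-cong-≗ (λ i → sum-cong-≗ λ j → trans (cong (_∧ w i j) (moves-∘ p q p-pres q-pres i j))
                                                   (∧-distribʳ-xor (w i j) (moves p i j) (moves q i j))) ⟩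
      sum (λ i → sum λ j → (moves p i j ∧ w i j) xor (moves q i j ∧ w i j))
        ≡⟨ sum-cong-≗ (λ i → ∑-distrib-+ (λ j → moves p i j ∧ w i j) (λ j → moves q i j ∧ w i j)) ⟩
      sum (λ i → sum (λ j → moves p i j ∧ w i j) xor sum (λ j → moves q i j ∧ w i j))
        ≡⟨ ∑-distrib-+ (λ i → sum λ j → moves p i j ∧ w i j) (λ i → sum λ j → moves q i j ∧ w i j) ⟩
      movesParity w p xor movesParity w q ∎
      where open ≡-Reasoning

    movesParity-transpose< : ∀ a b → a <ᶠ b → movesParity w (transpose a b) ≡ w a b
    movesParity-transpose< a b a<b =
      trans (sum-single _ a row-a) (trans (sum-single _ b column-b) (cong (_∧ w a b) (moves-transpose-self a b a<b)))
      where
      ∧-true : ∀ {x y} → x ∧ y ≡ true → x ≡ true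
      ∧-true {true} _ = refl
      column-b : ∀ j → moves (transpose a b) a j ∧ w a j ≡ true → j ≡ b
      column-b j m = proj₂ (moves-transpose-only a b a<b a j (∧-true m))
      row-a : ∀ i → sum (λ j → moves (transpose a b) i j ∧ w i j) ≡ true → i ≡ a
      row-a i s≡true = decidable-stable (i ≟ a) λ i≢a → true≢false (trans (sym s≡true)
        (sum-false _ λ j → ¬-not λ m → i≢a (proj₁ (moves-transpose-only a b a<b i j (∧-true m)))))

    movesParity-transpose : ∀ a b → a ≢ b → w b a ≡ w a b → movesParity w (transpose a b) ≡ w a b
    movesParity-transpose a b a≢b w-sym with a <? b
    ... | yes a<b = movesParity-transpose< a b a<b
    ... | no a≮b  = trans (movesParity-cong (transpose a b) (transpose b a) (λ k → sym (transpose-comm a b k)))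
                          (trans (movesParity-transpose< b a (≢∧≮⇒> a≢b a≮b)) w-sym)

  Swappable : Fin n × Fin n → Set
  Swappable (a , b) = a ≢ b × label a ≡ label b

  transpositions : List (Fin n × Fin n) → Permutation′ n
  transpositions []             = P.id
  transpositions ((a , b) ∷ ts) = transpose a b ∘ₚ transpositions ts

  moves-transpose-∘ : ∀ p → Preserving p → ∀ a b → moves p a b ≡ true → ∀ i j →
                      moves (transpose a b ∘ₚ p) i j ≡ true → moves p i j ≡ true × ¬ (i ≡ a × j ≡ b)
  moves-transpose-∘ p p-pres a b mab i j m′ with moves (transpose a b) i j in mt
  ... | true with moves-transpose-only a b a<b i j mt
    where a<b = moves⇒< p a b mab
  ...   | refl , refl = ⊥-elim (true≢false (trans (sym m′) (trans (split a b) (cong₂ _xor_ mt mab))))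
    where split = moves-∘ (transpose a b) p (transpose-preserving a b (proj₂ (moves⇒swappable p p-pres a b mab))) p-pres
  moves-transpose-∘ p p-pres a b mab i j m′ | false =
    trans (sym (trans (split i j) (cong (_xor moves p i j) mt))) m′ ,
    λ { (refl , refl) → true≢false (trans (sym (moves-transpose-self a b (moves⇒< p a b mab))) mt) }
    where split = moves-∘ (transpose a b) p (transpose-preserving a b (proj₂ (moves⇒swappable p p-pres a b mab))) p-pres

  private
    peel : ∀ (ℓ : List (Fin n × Fin n)) p → Preserving p → (∀ i j → moves p i j ≡ true → (i , j) ∈ ℓ) →
           ∃[ ts ] All Swappable ts × p P.≈ transpositions ts
    peel [] p p-pres moving-in = [] , [] , unmoved⇒id p p-pres (λ i j → ¬-not λ m → Any.¬Any[] (moving-in i j m))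
    peel ((a , b) ∷ ℓ) p p-pres moving-in with moves p a b in mab
    ... | false = peel ℓ p p-pres λ i j m → drop-head m (moving-in i j m)
      where
      drop-head : ∀ {i j} → moves p i j ≡ true → (i , j) ∈ (a , b) ∷ ℓ → (i , j) ∈ ℓ
      drop-head m (here refl)   = ⊥-elim (true≢false (trans (sym m) mab))
      drop-head m (there i,j∈ℓ) = i,j∈ℓ
    ... | true =
      (a , b) ∷ ts , ab-swappable ∷ swappable ,
      λ k → trans (cong (p ⟨$⟩ʳ_) (sym (transpose-involutive a b k))) (p′≈ts (transpose a b ⟨$⟩ʳ k))
      where
      ab-swappable = moves⇒swappable p p-pres a b mab
      p′ = transpose a b ∘ₚ p
      drop-head : ∀ {i j} → moves p i j ≡ true × ¬ (i ≡ a × j ≡ b) → (i , j) ∈ (a , b) ∷ ℓ → (i , j) ∈ ℓ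
      drop-head (_ , not-ab) (here refl)   = ⊥-elim (not-ab (refl , refl))
      drop-head _            (there i,j∈ℓ) = i,j∈ℓ
      rest = peel ℓ p′ (∘-preserving (transpose a b) p (transpose-preserving a b (proj₂ ab-swappable)) p-pres)
                   λ i j m′ → let m = moves-transpose-∘ p p-pres a b mab i j m′ in drop-head m (moving-in i j (proj₁ m))
      ts = proj₁ rest
      swappable = proj₁ (proj₂ rest)
      p′≈ts = proj₂ (proj₂ rest)

  preserving⇒transpositions : ∀ p → Preserving p → ∃[ ts ] All Swappable ts × p P.≈ transpositions ts
  preserving⇒transpositions p p-pres =
    peel (cartesianProduct (allFin n) (allFin n)) p p-pres λ i j _ → ∈-cartesianProduct⁺ (∈-allFin i) (∈-allFin j)

at-applyUpTo : ∀ {A : Set} (d : A) (f : ℕ → A) {n k} → k < n → at d (applyUpTo f n) k ≡ f k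
at-applyUpTo d f {suc n} {zero}  _         = refl
at-applyUpTo d f {suc n} {suc k} (s≤s k<n) = at-applyUpTo d (f ∘ suc) k<n

at-map-upTo : ∀ {A : Set} (d : A) (f : ℕ → A) {n k} → k < n → at d (map f (upTo n)) k ≡ f k
at-map-upTo d f {n} k<n = trans (cong (λ xs → at d xs _) (map-upTo f n)) (at-applyUpTo d f k<n)

map-at-upTo-length : ∀ {A : Set} (d : A) (xs : List A) → map (at d xs) (upTo (length xs)) ≡ xs
map-at-upTo-length d xs = trans (map-upTo (at d xs) (length xs)) (go xs)
  where
  go : ∀ xs → applyUpTo (at d xs) (length xs) ≡ xs
  go []       = refl
  go (x ∷ xs) = cong (x ∷_) (go xs)

map-upTo-cong : ∀ {A : Set} {f g : ℕ → A} n → (∀ {k} → k < n → f k ≡ g k) → map f (upTo n) ≡ map g (upTo n)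
map-upTo-cong n f≡g = map-cong-local (applyUpTo⁺₁ (λ k → k) n f≡g)

at-map-length : ∀ (T : Tableau) {i} → i < length T → at 0 (map length T) i ≡ length (at [] T i)
at-map-length (_ ∷ _) {zero}  _         = refl
at-map-length (_ ∷ T) {suc i} (s≤s i<n) = at-map-length T i<n

at-∈ : ∀ {A : Set} (d : A) xs {c} → c < length xs → at d xs c ∈ xs
at-∈ d (x ∷ xs) {zero}  _         = here refl
at-∈ d (x ∷ xs) {suc c} (s≤s c<n) = there (at-∈ d xs c<n)

at-injective : ∀ {A : Set} (d : A) {xs} → Unique xs → ∀ {c c′} → c < length xs → c′ < length xs →
               at d xs c ≡ at d xs c′ → c ≡ c′
at-injective d {x ∷ xs} (_ ∷ _)  {zero}  {zero}   _         _          _ = refl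
at-injective d {x ∷ xs} (x∉ ∷ _) {zero}  {suc c′} _         (s≤s c′<n) e = ⊥-elim (All.lookup x∉ (at-∈ d xs c′<n) e)
at-injective d {x ∷ xs} (x∉ ∷ _) {suc c} {zero}   (s≤s c<n) _          e = ⊥-elim (All.lookup x∉ (at-∈ d xs c<n) (sym e))
at-injective d {x ∷ xs} (_ ∷ u)  {suc c} {suc c′} (s≤s c<n) (s≤s c′<n) e = cong suc (at-injective d u c<n c′<n e)

all-≤-head : ∀ {l ls} → Linked _≥_ (l ∷ ls) → All (_≤ l) ls
all-≤-head [-]            = []
all-≤-head (l≥l′ ∷ sorted) = l≥l′ ∷ All.map (λ x≤l′ → ℕ.≤-trans x≤l′ l≥l′) (all-≤-head sorted)

at-≤ : ∀ {l ls} → All (_≤ l) ls → ∀ r → at 0 ls r ≤ l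
at-≤ []          r       = z≤n
at-≤ (x≤l ∷ _)   zero    = x≤l
at-≤ (_ ∷ ls≤l)  (suc r) = at-≤ ls≤l r

colLenAux-≥ : ∀ {c ls} → All (_≤ c) ls → colLenAux ls c ≡ 0
colLenAux-≥ []                     = refl
colLenAux-≥ {c} {l ∷ _} (l≤c ∷ ls≤c) with c ℕ.<? l
... | yes c<l = ⊥-elim (ℕ.<-irrefl refl (ℕ.<-≤-trans c<l l≤c))
... | no _    = colLenAux-≥ ls≤c

colLenAux-∷ : ∀ {l} ls {c} → c < l → colLenAux (l ∷ ls) c ≡ suc (colLenAux ls c)
colLenAux-∷ {l} ls {c} c<l with c ℕ.<? l
... | yes _   = refl
... | no c≮l  = ⊥-elim (c≮l c<l)

rowLen-antitone : ∀ {xs} → Linked _≥_ xs → ∀ {r s} → r ≤ s → at 0 xs s ≤ at 0 xs r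
rowLen-antitone {[]}    _  _                  = z≤n
rowLen-antitone {_ ∷ _} _  {zero} {zero} _    = ℕ.≤-refl
rowLen-antitone {_ ∷ _} xs {zero} {suc s} _   = at-≤ (all-≤-head xs) s
rowLen-antitone {_ ∷ _} xs (s≤s r≤s)          = rowLen-antitone (Linked.tail xs) r≤s

box⇒row<colLen : ∀ {xs} → Linked _≥_ xs → ∀ r c → c < at 0 xs r → r < colLenAux xs c
box⇒row<colLen {l ∷ ls} xs r c c<ℓr with c ℕ.<? l
box⇒row<colLen {l ∷ ls} xs zero    c _    | yes _   = s≤s z≤n
box⇒row<colLen {l ∷ ls} xs (suc r) c c<ℓr | yes _   = s≤s (box⇒row<colLen (Linked.tail xs) r c c<ℓr)
box⇒row<colLen {l ∷ ls} xs zero    c c<l  | no c≮l  = ⊥-elim (c≮l c<l)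
box⇒row<colLen {l ∷ ls} xs (suc r) c c<ℓr | no c≮l  = ⊥-elim (c≮l (ℕ.<-≤-trans c<ℓr (at-≤ (all-≤-head xs) r)))

row<colLen⇒box : ∀ {xs} → Linked _≥_ xs → ∀ r c → r < colLenAux xs c → c < at 0 xs r
row<colLen⇒box {l ∷ ls} xs r c r<ℓc with c ℕ.<? l
row<colLen⇒box {l ∷ ls} xs zero    c _          | yes c<l = c<l
row<colLen⇒box {l ∷ ls} xs (suc r) c (s≤s r<ℓc) | yes _   = row<colLen⇒box (Linked.tail xs) r c r<ℓc
row<colLen⇒box {l ∷ ls} xs r       c r<ℓc       | no c≮l
  rewrite colLenAux-≥ {c} {ls} (All.map (λ x≤l → ℕ.≤-trans x≤l (ℕ.≮⇒≥ c≮l)) (all-≤-head xs)) = ⊥-elim (ℕ.n≮0 r<ℓc)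

all-≤-of-head : ∀ {xs c} → Linked _≥_ xs → at 0 xs 0 ≤ c → All (_≤ c) xs
all-≤-of-head {[]}    _      _   = []
all-≤-of-head {_ ∷ _} sorted l≤c = l≤c ∷ All.map (λ x≤l → ℕ.≤-trans x≤l l≤c) (all-≤-head sorted)

colLen-between : ∀ {xs} → Linked _≥_ xs → ∀ k {c} → at 0 xs (suc k) ≤ c → c < at 0 xs k → colLenAux xs c ≡ suc k
colLen-between {l ∷ ls} sorted zero    ℓ₁≤c c<l =
  trans (colLenAux-∷ ls c<l) (cong suc (colLenAux-≥ (all-≤-of-head (Linked.tail sorted) ℓ₁≤c)))
colLen-between {l ∷ ls} sorted (suc k) ℓ≤c c<ℓ =
  trans (colLenAux-∷ ls (ℕ.<-≤-trans c<ℓ (at-≤ (all-≤-head sorted) k)))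
        (cong suc (colLen-between (Linked.tail sorted) k ℓ≤c c<ℓ))

box⇒row<length : ∀ (xs : List ℕ) {r c} → c < at 0 xs r → r < length xs
box⇒row<length (_ ∷ _)  {zero}  _    = s≤s z≤n
box⇒row<length (_ ∷ xs) {suc r} c<ℓr = s≤s (box⇒row<length xs c<ℓr)

module _ (sh : Shape) where

  act-entry : ∀ g T {i j} → i < nRows sh → j < rowLen sh i →
              entry (act sh g T) i j ≡ app (π g) (entry T (appInv (σ g) i) (appInv (τ g) j))
  act-entry g T i<n j<ℓi = trans (cong (λ row → at 0 row _) (at-map-upTo [] _ i<n)) (at-map-upTo 0 _ j<ℓi)

  act-cong : ∀ {g h} T → g ≈ᵢ h → act sh g T ≡ act sh h T
  act-cong {g} {h} T (σ≈ , τ≈ , π≈) =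
    map-cong (λ i → map-cong (λ j → trans (app-cong π≈ _)
      (cong (app (π h)) (cong₂ (entry T) (app-cong (flip-cong {p = σ g} {σ h} σ≈) i)
                                         (app-cong (flip-cong {p = τ g} {τ h} τ≈) j)))) _) _

  act-id : ∀ T → map length T ≡ sh → act sh (idIso sh) T ≡ T
  act-id T refl = begin
    act sh (idIso sh) T
      ≡⟨ map-cong (λ i → map-cong (λ j → trans (app-id {nCols sh} _)
           (cong₂ (entry T) (appInv-id {nRows sh} i) (appInv-id {nCols sh} j))) _) _ ⟩
    map (λ i → map (at 0 (at [] T i)) (upTo (rowLen sh i))) (upTo (nRows sh))
      ≡⟨ map-upTo-cong (nRows sh) (λ i<n → trans
           (cong (λ ℓ → map (at 0 (at [] T _)) (upTo ℓ)) (at-map-length T (subst (_ <_) (length-map length T) i<n)))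
           (map-at-upTo-length 0 (at [] T _))) ⟩
    map (at [] T) (upTo (nRows sh))
      ≡⟨ cong (λ ℓ → map (at [] T) (upTo ℓ)) (length-map length T) ⟩
    map (at [] T) (upTo (length T))
      ≡⟨ map-at-upTo-length [] T ⟩
    T ∎
    where open ≡-Reasoning

  module _ (sorted : Linked _≥_ sh) where

    appInv-box : ∀ g → InIsoGroup sh g → ∀ {i j} → i < nRows sh → j < rowLen sh i →
                 appInv (τ g) j < rowLen sh (appInv (σ g) i)
    appInv-box g (σ-pres , τ-pres , _) {i} {j} i<n j<ℓi =
      row<colLen⇒box sorted (appInv (σ g) i) (appInv (τ g) j)
        (subst (appInv (σ g) i <_) (sym (appInv-preserving (colLen sh) (τ g) τ-pres j))
          (box⇒row<colLen sorted (appInv (σ g) i) j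
            (subst (j <_) (sym (appInv-preserving (rowLen sh) (σ g) σ-pres i)) j<ℓi)))

    act-∘ : ∀ g h T → InIsoGroup sh h → act sh (g ⊙ h) T ≡ act sh h (act sh g T)
    act-∘ g h T h∈G =
      map-upTo-cong (nRows sh) λ i<n → map-upTo-cong (rowLen sh _) λ j<ℓi →
        trans (app-∘ (π g) (π h) _)
          (cong (app (π h)) (trans (cong (app (π g)) (cong₂ (entry T) (app-∘ (P.flip (σ h)) (P.flip (σ g)) _)
                                                                       (app-∘ (P.flip (τ h)) (P.flip (τ g)) _)))
            (sym (act-entry g T (app-bounded (P.flip (σ h)) i<n) (appInv-box h h∈G i<n j<ℓi)))))

-- The isotopy group of a squareable shape

data Axis : Set where
  rows columns symbols : Axis

module IsotopyGroup (sh : Shape) (sq : Squareable sh) where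

  axisSize : Axis → ℕ
  axisSize rows    = nRows sh
  axisSize columns = nCols sh
  axisSize symbols = nCols sh

  axisLabel : (a : Axis) → Fin (axisSize a) → ℕ
  axisLabel rows    i = rowLen sh (toℕ i)
  axisLabel columns j = colLen sh (toℕ j)
  axisLabel symbols x = entryFreq sh (toℕ x)

  axis-no-three : ∀ a (i j k : Fin (axisSize a)) → i ≢ j → j ≢ k → i ≢ k →
                  ¬ (axisLabel a i ≡ axisLabel a j × axisLabel a j ≡ axisLabel a k)
  axis-no-three rows    = proj₁ sq
  axis-no-three columns = proj₂ sq
  -- entryFreq is colLen, so squareability also bounds the classes of equally frequent symbols
  axis-no-three symbols = proj₂ sq

  module Along (a : Axis) = AtMostTwoPerLabel (axisLabel a) (axis-no-three a)
  open Along public using (Preserving; Swappable)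

  component : (a : Axis) → Iso sh → Permutation′ (axisSize a)
  component rows    = σ
  component columns = τ
  component symbols = π

  along : (a : Axis) → Permutation′ (axisSize a) → Iso sh
  along rows    p = iso p P.id P.id
  along columns p = iso P.id p P.id
  along symbols p = iso P.id P.id p

  ≈ᵢ-refl : ∀ {g : Iso sh} → g ≈ᵢ g
  ≈ᵢ-refl = (λ _ → refl) , (λ _ → refl) , (λ _ → refl)

  ≈ᵢ-sym : ∀ {g h : Iso sh} → g ≈ᵢ h → h ≈ᵢ g
  ≈ᵢ-sym (σ≈ , τ≈ , π≈) = sym ∘ σ≈ , sym ∘ τ≈ , sym ∘ π≈

  ≈ᵢ-trans : ∀ {g h k : Iso sh} → g ≈ᵢ h → h ≈ᵢ k → g ≈ᵢ k
  ≈ᵢ-trans (σ≈ , τ≈ , π≈) (σ≈′ , τ≈′ , π≈′) =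
    (λ i → trans (σ≈ i) (σ≈′ i)) , (λ j → trans (τ≈ j) (τ≈′ j)) , (λ x → trans (π≈ x) (π≈′ x))

  ⊙-congʳ : ∀ g {h h′ : Iso sh} → h ≈ᵢ h′ → (g ⊙ h) ≈ᵢ (g ⊙ h′)
  ⊙-congʳ g (σ≈ , τ≈ , π≈) = σ≈ ∘ (σ g ⟨$⟩ʳ_) , τ≈ ∘ (τ g ⟨$⟩ʳ_) , π≈ ∘ (π g ⟨$⟩ʳ_)

  along-cong : ∀ a {p q} → p P.≈ q → along a p ≈ᵢ along a q
  along-cong rows    p≈q = p≈q , (λ _ → refl) , (λ _ → refl)
  along-cong columns p≈q = (λ _ → refl) , p≈q , (λ _ → refl)
  along-cong symbols p≈q = (λ _ → refl) , (λ _ → refl) , p≈q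

  ⊙-along-id : ∀ g a → g ≈ᵢ (g ⊙ along a P.id)
  ⊙-along-id g rows    = (λ _ → refl) , (λ _ → refl) , (λ _ → refl)
  ⊙-along-id g columns = (λ _ → refl) , (λ _ → refl) , (λ _ → refl)
  ⊙-along-id g symbols = (λ _ → refl) , (λ _ → refl) , (λ _ → refl)

  ⊙-along-∘ : ∀ g a p q → ((g ⊙ along a p) ⊙ along a q) ≈ᵢ (g ⊙ along a (p ∘ₚ q))
  ⊙-along-∘ g rows    p q = (λ _ → refl) , (λ _ → refl) , (λ _ → refl)
  ⊙-along-∘ g columns p q = (λ _ → refl) , (λ _ → refl) , (λ _ → refl)
  ⊙-along-∘ g symbols p q = (λ _ → refl) , (λ _ → refl) , (λ _ → refl)

  ∈G⇒preserving : ∀ g → InIsoGroup sh g → ∀ a → Preserving a (component a g)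
  ∈G⇒preserving _ (σ-pres , _ , _) rows    = σ-pres
  ∈G⇒preserving _ (_ , τ-pres , _) columns = τ-pres
  ∈G⇒preserving _ (_ , _ , π-pres) symbols = π-pres

  along-∈G : ∀ a p → Preserving a p → InIsoGroup sh (along a p)
  along-∈G rows    _ p-pres = p-pres , (λ _ → refl) , (λ _ → refl)
  along-∈G columns _ p-pres = (λ _ → refl) , p-pres , (λ _ → refl)
  along-∈G symbols _ p-pres = (λ _ → refl) , (λ _ → refl) , p-pres

  id-∈G : InIsoGroup sh (idIso sh)
  id-∈G = (λ _ → refl) , (λ _ → refl) , (λ _ → refl)

  ⊙-∈G : ∀ g h → InIsoGroup sh g → InIsoGroup sh h → InIsoGroup sh (g ⊙ h)
  ⊙-∈G _ _ (σg , τg , πg) (σh , τh , πh) =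
    (λ i → trans (σh _) (σg i)) , (λ j → trans (τh _) (τg j)) , (λ x → trans (πh _) (πg x))

  ⊙-comm : ∀ g h → InIsoGroup sh g → InIsoGroup sh h → (g ⊙ h) ≈ᵢ (h ⊙ g)
  ⊙-comm g h (σg , τg , πg) (σh , τh , πh) =
    Along.preserving-comm rows (σ h) (σ g) σh σg ,
    Along.preserving-comm columns (τ h) (τ g) τh τg ,
    Along.preserving-comm symbols (π h) (π g) πh πg

  ⊙-self : ∀ g → InIsoGroup sh g → (g ⊙ g) ≈ᵢ idIso sh
  ⊙-self g (σg , τg , πg) =
    Along.preserving-involutive rows (σ g) σg ,
    Along.preserving-involutive columns (τ g) τg ,
    Along.preserving-involutive symbols (π g) πg

  ⊙-cancelˡ : ∀ g h → InIsoGroup sh g → h ≈ᵢ (g ⊙ (g ⊙ h))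
  ⊙-cancelˡ g h g∈G =
    let (σ≈ , τ≈ , π≈) = ⊙-self g g∈G
    in (λ i → cong (σ h ⟨$⟩ʳ_) (sym (σ≈ i))) , (λ j → cong (τ h ⟨$⟩ʳ_) (sym (τ≈ j))) , (λ x → cong (π h ⟨$⟩ʳ_) (sym (π≈ x)))

  ⊙-left-comm : ∀ g h k → InIsoGroup sh g → InIsoGroup sh h → (g ⊙ (h ⊙ k)) ≈ᵢ (h ⊙ (g ⊙ k))
  ⊙-left-comm g h k g∈G h∈G =
    let (σ≈ , τ≈ , π≈) = ⊙-comm g h g∈G h∈G
    in cong (σ k ⟨$⟩ʳ_) ∘ σ≈ , cong (τ k ⟨$⟩ʳ_) ∘ τ≈ , cong (π k ⟨$⟩ʳ_) ∘ π≈

  record ElementaryView (e : Iso sh) : Set where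
    constructor view
    field
      axis      : Axis
      i j       : Fin (axisSize axis)
      swappable : Swappable axis (i , j)
      e≡along   : e ≡ along axis (transpose i j)

  elementary-view : ∀ {e : Iso sh} → Elementary sh e → ElementaryView e
  elementary-view (rowSwap i j i≢j i~j) = view rows    i j (i≢j , i~j) refl
  elementary-view (colSwap i j i≢j i~j) = view columns i j (i≢j , i~j) refl
  elementary-view (entSwap x y x≢y x~y) = view symbols x y (x≢y , x~y) refl

  along-transpose-elementary : ∀ a i j → Swappable a (i , j) → Elementary sh (along a (transpose i j))
  along-transpose-elementary rows    i j (i≢j , i~j) = rowSwap i j i≢j i~j
  along-transpose-elementary columns i j (i≢j , i~j) = colSwap i j i≢j i~j
  along-transpose-elementary symbols i j (i≢j , i~j) = entSwap i j i≢j i~j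

  elementary-∈G : ∀ {e : Iso sh} → Elementary sh e → InIsoGroup sh e
  elementary-∈G e-elem = view-∈G (elementary-view e-elem)
    where
    view-∈G : ∀ {e} → ElementaryView e → InIsoGroup sh e
    view-∈G (view a i j (_ , i~j) refl) = along-∈G a (transpose i j) (Along.transpose-preserving a i j i~j)

-- Latin tableaux and symmetric pairs of columns

module LatinRows (sh : Shape) (T : Tableau) (latin : IsLatin sh T) where

  private
    row-↭ : ∀ {r} → r < nRows sh → at [] T r ↭ upTo (rowLen sh r)
    row-↭ r<n = proj₁ (proj₂ latin) _ r<n

    length-row : ∀ {r} → r < nRows sh → length (at [] T r) ≡ rowLen sh r
    length-row {r} r<n with proj₁ latin
    ... | refl = sym (at-map-length T (subst (r <_) (length-map length T) r<n))

    in-row : ∀ {r c} → r < nRows sh → c < rowLen sh r → c < length (at [] T r)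
    in-row r<n = subst (_ <_) (sym (length-row r<n))

  entry-< : ∀ {r c} → r < nRows sh → c < rowLen sh r → entry T r c < rowLen sh r
  entry-< r<n c<ℓ = ∈-upTo⁻ (∈-resp-↭ (row-↭ r<n) (at-∈ 0 (at [] T _) (in-row r<n c<ℓ)))

  entry-injective : ∀ {r c c′} → r < nRows sh → c < rowLen sh r → c′ < rowLen sh r →
                    entry T r c ≡ entry T r c′ → c ≡ c′
  entry-injective r<n c<ℓ c′<ℓ =
    at-injective 0 (↭ₛ.Unique-resp-↭ (setoid ℕ) (↭⇒↭ₛ (↭-sym (row-↭ r<n))) (upTo⁺ _)) (in-row r<n c<ℓ) (in-row r<n c′<ℓ)

  entry-≢ : ∀ {r} {C K : Fin (nCols sh)} → r < nRows sh → toℕ C < rowLen sh r → toℕ K < rowLen sh r →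
            C ≢ K → entry T r (toℕ C) ≢ entry T r (toℕ K)
  entry-≢ r<n C<ℓ K<ℓ C≢K e = C≢K (toℕ-injective (entry-injective r<n C<ℓ K<ℓ e))

module SymmetricPairs (sh : Shape) (sorted : Linked _≥_ sh) (T : Tableau) (latin : IsLatin sh T) where

  open LatinRows sh T latin

  FixedBy : (i j x y : Fin (nCols sh)) → ℕ → Set
  FixedBy i j x y r = ∀ C → toℕ C < rowLen sh r →
    app (transpose x y) (entry T r (toℕ (transpose i j ⟨$⟩ʳ C))) ≡ entry T r (toℕ C)

  swap-fixes-row : ∀ {r} (i j x y : Fin (nCols sh)) → r < nRows sh → toℕ i < rowLen sh r → toℕ j < rowLen sh r →
    (entry T r (toℕ i) ≡ toℕ x × entry T r (toℕ j) ≡ toℕ y) ⊎ (entry T r (toℕ i) ≡ toℕ y × entry T r (toℕ j) ≡ toℕ x) →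
    FixedBy i j x y r
  swap-fixes-row {r} i j x y r<n i<ℓ j<ℓ values C C<ℓ with transpose-view i j C | values
  ... | at-i refl t | inj₁ (eᵢ≡x , eⱼ≡y) rewrite t | eⱼ≡y = trans (app-transposeʳ x y) (sym eᵢ≡x)
  ... | at-i refl t | inj₂ (eᵢ≡y , eⱼ≡x) rewrite t | eⱼ≡x = trans (app-transposeˡ x y) (sym eᵢ≡y)
  ... | at-j refl t | inj₁ (eᵢ≡x , eⱼ≡y) rewrite t | eᵢ≡x = trans (app-transposeˡ x y) (sym eⱼ≡y)
  ... | at-j refl t | inj₂ (eᵢ≡y , eⱼ≡x) rewrite t | eᵢ≡y = trans (app-transposeʳ x y) (sym eⱼ≡x)
  ... | elsewhere C≢i C≢j t | inj₁ (eᵢ≡x , eⱼ≡y) rewrite t =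
    app-transpose-≢ x y (λ e → entry-≢ r<n C<ℓ i<ℓ C≢i (trans e (sym eᵢ≡x)))
                        (λ e → entry-≢ r<n C<ℓ j<ℓ C≢j (trans e (sym eⱼ≡y)))
  ... | elsewhere C≢i C≢j t | inj₂ (eᵢ≡y , eⱼ≡x) rewrite t =
    app-transpose-≢ x y (λ e → entry-≢ r<n C<ℓ j<ℓ C≢j (trans e (sym eⱼ≡x)))
                        (λ e → entry-≢ r<n C<ℓ i<ℓ C≢i (trans e (sym eᵢ≡y)))

  swap-fixes-short-row : ∀ {r m} (i j x y : Fin (nCols sh)) → r < nRows sh → rowLen sh r ≤ m →
    m ≤ toℕ i → m ≤ toℕ j → m ≤ toℕ x → m ≤ toℕ y → FixedBy i j x y r
  swap-fixes-short-row {r} i j x y r<n ℓ≤m m≤i m≤j m≤x m≤y C C<ℓ =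
    trans (cong (λ K → app (transpose x y) (entry T r (toℕ K))) (transpose-apply-≢ i j C (beyond m≤i) (beyond m≤j)))
          (app-transpose-≢ x y (small-entry m≤x) (small-entry m≤y))
    where
    beyond : ∀ {K} → _ ≤ toℕ K → C ≢ K
    beyond m≤K refl = ℕ.<-irrefl refl (ℕ.<-≤-trans C<ℓ (ℕ.≤-trans ℓ≤m m≤K))
    small-entry : ∀ {v} → _ ≤ v → entry T _ (toℕ C) ≢ v
    small-entry m≤v refl = ℕ.<-irrefl refl (ℕ.<-≤-trans (entry-< r<n C<ℓ) (ℕ.≤-trans ℓ≤m m≤v))

  symPair-fixes-rows : ∀ {i j x y} → SymPair sh T i j x y → ∀ r → r < nRows sh → FixedBy i j x y r
  symPair-fixes-rows {i} {j} {x} {y} (type1 _ _ m≤i m≤j e₀ᵢ e₀ⱼ m≤x _ m≤y _) zero r<n =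
    swap-fixes-row i j x y r<n (toℕ<n i) (toℕ<n j) (inj₁ (e₀ᵢ , e₀ⱼ))
  symPair-fixes-rows {i} {j} {x} {y} (type1 _ _ m≤i m≤j e₀ᵢ e₀ⱼ m≤x _ m≤y _) (suc r) r<n =
    swap-fixes-short-row i j x y r<n (rowLen-antitone sorted (s≤s z≤n)) m≤i m≤j m≤x m≤y
  symPair-fixes-rows {i} {j} {x} {y} (type2 _ _ _ _ _ _ e₀ᵢ e₀ⱼ _ _ _ _ _ _) zero r<n =
    swap-fixes-row i j x y r<n (toℕ<n i) (toℕ<n j) (inj₁ (e₀ᵢ , e₀ⱼ))
  symPair-fixes-rows {i} {j} {x} {y} (type2 _ _ _ i<ℓ _ j<ℓ _ _ e₁ᵢ e₁ⱼ _ _ _ _) (suc zero) r<n =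
    swap-fixes-row i j x y r<n i<ℓ j<ℓ (inj₂ (e₁ᵢ , e₁ⱼ))
  symPair-fixes-rows {i} {j} {x} {y} (type2 _ _ m≤i _ m≤j _ _ _ _ _ m≤x _ m≤y _) (suc (suc r)) r<n =
    swap-fixes-short-row i j x y r<n (rowLen-antitone sorted (s≤s (s≤s z≤n))) m≤i m≤j m≤x m≤y

  symPair-symmetry : ∀ {i j x y} → SymPair sh T i j x y → act sh (symPairIso sh i j x y) T ≡ T
  symPair-symmetry {i} {j} {x} {y} pair =
    trans (map-upTo-cong (nRows sh) λ {r} r<n → map-upTo-cong (rowLen sh r) λ c<ℓ → fixed r<n c<ℓ)
          (act-id sh T (proj₁ latin))
    where
    open ≡-Reasoning
    fixed : ∀ {r c} → r < nRows sh → c < rowLen sh r →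
            app (transpose x y) (entry T (appInv (P.id {nRows sh}) r) (appInv (transpose i j) c))
            ≡ app (P.id {nCols sh}) (entry T (appInv (P.id {nRows sh}) r) (appInv (P.id {nCols sh}) c))
    fixed {r} {c} r<n c<ℓ = begin
      app (transpose x y) (entry T (appInv (P.id {nRows sh}) r) (appInv (transpose i j) c))
        ≡⟨ cong₂ (λ r′ c′ → app (transpose x y) (entry T r′ c′)) (appInv-id {nRows sh} r)
                 (trans (app-< (P.flip (transpose i j)) c<n) (cong toℕ (transpose-comm i j C))) ⟩
      app (transpose x y) (entry T r (toℕ (transpose i j ⟨$⟩ʳ C)))
        ≡⟨ symPair-fixes-rows pair r r<n C (subst (_< rowLen sh r) (sym (toℕ-fromℕ< c<n)) c<ℓ) ⟩
      entry T r (toℕ C)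
        ≡⟨ cong (entry T r) (toℕ-fromℕ< c<n) ⟩
      entry T r c
        ≡⟨ sym (trans (app-id {nCols sh} _) (cong₂ (entry T) (appInv-id {nRows sh} r) (appInv-id {nCols sh} c))) ⟩
      app (P.id {nCols sh}) (entry T (appInv (P.id {nRows sh}) r) (appInv (P.id {nCols sh}) c)) ∎
      where
      c<n : c < nCols sh
      c<n = ℕ.<-≤-trans c<ℓ (rowLen-antitone sorted z≤n)
      C : Fin (nCols sh)
      C = fromℕ< c<n

  symPair-columns : ∀ {i j x y} → SymPair sh T i j x y → i ≢ j × colLen sh (toℕ i) ≡ colLen sh (toℕ j)
  symPair-columns {i} {j} (type1 i≢j _ m≤i m≤j _ _ _ _ _ _) =
    i≢j , trans (colLen-between sorted 0 m≤i (toℕ<n i)) (sym (colLen-between sorted 0 m≤j (toℕ<n j)))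
  symPair-columns (type2 i≢j _ m≤i i<ℓ m≤j j<ℓ _ _ _ _ _ _ _ _) =
    i≢j , trans (colLen-between sorted 1 m≤i i<ℓ) (sym (colLen-between sorted 1 m≤j j<ℓ))

  first-row-distinct : ∀ {i j : Fin (nCols sh)} {x y : Fin (nCols sh)} → i ≢ j →
                       entry T 0 (toℕ i) ≡ toℕ x → entry T 0 (toℕ j) ≡ toℕ y → x ≢ y
  first-row-distinct {i} {j} i≢j e₀ᵢ e₀ⱼ refl =
    entry-≢ (box⇒row<length sh (toℕ<n i)) (toℕ<n i) (toℕ<n j) i≢j (trans e₀ᵢ (sym e₀ⱼ))

  symPair-symbols : ∀ {i j x y} → SymPair sh T i j x y → x ≢ y × entryFreq sh (toℕ x) ≡ entryFreq sh (toℕ y)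
  symPair-symbols {i} {j} (type1 i≢j _ _ _ e₀ᵢ e₀ⱼ m≤x x<ℓ m≤y y<ℓ) =
    first-row-distinct i≢j e₀ᵢ e₀ⱼ ,
    trans (colLen-between sorted 0 m≤x x<ℓ) (sym (colLen-between sorted 0 m≤y y<ℓ))
  symPair-symbols {i} {j} (type2 i≢j _ _ _ _ _ e₀ᵢ e₀ⱼ _ _ m≤x x<ℓ m≤y y<ℓ) =
    first-row-distinct i≢j e₀ᵢ e₀ⱼ ,
    trans (colLen-between sorted 1 m≤x x<ℓ) (sym (colLen-between sorted 1 m≤y y<ℓ))

-- The signature χ and the cube

_≟ₜ_ : (V W : Tableau) → Dec (V ≡ W)
_≟ₜ_ = ≡-dec (≡-dec ℕ._≟_)

module Signature (sh : Shape) (sq : Squareable sh) (T : Tableau) where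

  open IsotopyGroup sh sq

  image : Iso sh → Tableau
  image g = act sh g T

  weight : (a : Axis) → Tableau → Fin (axisSize a) → Fin (axisSize a) → Bool
  weight a W i j = does (image (along a (transpose i j)) ≟ₜ W)

  axisParity : Tableau → Iso sh → Axis → Bool
  axisParity W g a = Along.movesParity a (weight a W) (component a g)

  -- the parity of the number of 2-cycles of g whose transposition carries T to W
  χ : Tableau → Iso sh → Bool
  χ W g = axisParity W g rows xor (axisParity W g columns xor axisParity W g symbols)

  axisParity-⊙ : ∀ W g h → InIsoGroup sh g → InIsoGroup sh h →
                 ∀ a → axisParity W (g ⊙ h) a ≡ axisParity W g a xor axisParity W h a
  axisParity-⊙ W g h g∈G h∈G rows =
    Along.movesParity-∘ rows (weight rows W) (σ g) (σ h) (∈G⇒preserving g g∈G rows) (∈G⇒preserving h h∈G rows)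
  axisParity-⊙ W g h g∈G h∈G columns =
    Along.movesParity-∘ columns (weight columns W) (τ g) (τ h) (∈G⇒preserving g g∈G columns) (∈G⇒preserving h h∈G columns)
  axisParity-⊙ W g h g∈G h∈G symbols =
    Along.movesParity-∘ symbols (weight symbols W) (π g) (π h) (∈G⇒preserving g g∈G symbols) (∈G⇒preserving h h∈G symbols)

  χ-⊙ : ∀ W g h → InIsoGroup sh g → InIsoGroup sh h → χ W (g ⊙ h) ≡ χ W g xor χ W h
  χ-⊙ W g h g∈G h∈G = begin
    χ W (g ⊙ h)
      ≡⟨ cong₂ _xor_ (parity rows) (cong₂ _xor_ (parity columns) (parity symbols)) ⟩
    (r g xor r h) xor ((c g xor c h) xor (s g xor s h))
      ≡⟨ cong ((r g xor r h) xor_) (interchange (c g) (c h) (s g) (s h)) ⟩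
    (r g xor r h) xor ((c g xor s g) xor (c h xor s h))
      ≡⟨ interchange (r g) (r h) (c g xor s g) (c h xor s h) ⟩
    χ W g xor χ W h ∎
    where
    open ≡-Reasoning
    parity = axisParity-⊙ W g h g∈G h∈G
    r c s : Iso sh → Bool
    r k = axisParity W k rows
    c k = axisParity W k columns
    s k = axisParity W k symbols

  χ-cong : ∀ W {g h : Iso sh} → g ≈ᵢ h → χ W g ≡ χ W h
  χ-cong W {g} {h} (σ≈ , τ≈ , π≈) =
    cong₂ _xor_ (Along.movesParity-cong rows _ (σ g) (σ h) σ≈)
      (cong₂ _xor_ (Along.movesParity-cong columns _ (τ g) (τ h) τ≈) (Along.movesParity-cong symbols _ (π g) (π h) π≈))

  χ-id : ∀ W → χ W (idIso sh) ≡ false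
  χ-id W = cong₂ _xor_ (Along.movesParity-id rows (weight rows W))
             (cong₂ _xor_ (Along.movesParity-id columns (weight columns W)) (Along.movesParity-id symbols (weight symbols W)))

  weight-comm : ∀ a W i j → weight a W j i ≡ weight a W i j
  weight-comm a W i j = cong (λ V → does (V ≟ₜ W)) (act-cong sh T (along-cong a (transpose-comm i j)))

  χ-along-transpose : ∀ W a i j → Swappable a (i , j) → χ W (along a (transpose i j)) ≡ weight a W i j
  χ-along-transpose W rows i j (i≢j , _) = trans
    (cong₂ _xor_ (Along.movesParity-transpose rows (weight rows W) i j i≢j (weight-comm rows W i j))
      (cong₂ _xor_ (Along.movesParity-id columns (weight columns W)) (Along.movesParity-id symbols (weight symbols W))))
    (xor-identityʳ _)
  χ-along-transpose W columns i j (i≢j , _) = trans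
    (cong₂ _xor_ (Along.movesParity-id rows (weight rows W))
      (cong₂ _xor_ (Along.movesParity-transpose columns (weight columns W) i j i≢j (weight-comm columns W i j))
                   (Along.movesParity-id symbols (weight symbols W))))
    (xor-identityʳ _)
  χ-along-transpose W symbols i j (i≢j , _) =
    cong₂ _xor_ (Along.movesParity-id rows (weight rows W))
      (cong₂ _xor_ (Along.movesParity-id columns (weight columns W))
                   (Along.movesParity-transpose symbols (weight symbols W) i j i≢j (weight-comm symbols W i j)))

  χ-elementary : ∀ W {e : Iso sh} → Elementary sh e → χ W e ≡ does (image e ≟ₜ W)
  χ-elementary W e-elem = χ-view (elementary-view e-elem)
    where
    χ-view : ∀ {e} → ElementaryView e → χ W e ≡ does (image e ≟ₜ W)
    χ-view (view a i j swappable refl) = χ-along-transpose W a i j swappable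

module OrbitSignature (sh : Shape) (isP : IsPartition sh) (sq : Squareable sh) (T : Tableau) (latin : IsLatin sh T)
  (only-pair-symmetries : ∀ g → IsSymmetry sh T g → Nontrivial sh g → ArisesFromSymPairs sh T g) where

  open IsotopyGroup sh sq
  open Signature sh sq T
  open SymmetricPairs sh (proj₁ isP) T latin

  image-id : image (idIso sh) ≡ T
  image-id = act-id sh T (proj₁ latin)

  -- s_(x,y) c_(i,j) fixes T, so c_(i,j) and s_(x,y) move T to the same tableau
  χ-symPair : ∀ W {i j x y} → SymPair sh T i j x y →
              InIsoGroup sh (symPairIso sh i j x y) × χ W (symPairIso sh i j x y) ≡ false
  χ-symPair W {i} {j} {x} {y} pair =
    ⊙-∈G c s c∈G s∈G ,
    (begin
      χ W (c ⊙ s)                                       ≡⟨ χ-⊙ W c s c∈G s∈G ⟩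
      χ W c xor χ W s                                   ≡⟨ cong₂ _xor_ (χ-along-transpose W columns i j i~j)
                                                                       (χ-along-transpose W symbols x y x~y) ⟩
      does (image c ≟ₜ W) xor does (image s ≟ₜ W)      ≡⟨ cong (λ V → does (V ≟ₜ W) xor does (image s ≟ₜ W)) c≡s ⟩
      does (image s ≟ₜ W) xor does (image s ≟ₜ W)      ≡⟨ xor-same (does (image s ≟ₜ W)) ⟩
      false                                             ∎)
    where
    open ≡-Reasoning
    c = along columns (transpose i j)
    s = along symbols (transpose x y)
    i~j = symPair-columns pair
    x~y = symPair-symbols pair
    c∈G = along-∈G columns (transpose i j) (Along.transpose-preserving columns i j (proj₂ i~j))
    s∈G = along-∈G symbols (transpose x y) (Along.transpose-preserving symbols x y (proj₂ x~y))
    c≡s : image c ≡ image s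
    c≡s = begin
      act sh c T                       ≡⟨ cong (act sh c) (sym (symPair-symmetry pair)) ⟩
      act sh c (act sh (c ⊙ s) T)      ≡⟨ sym (act-∘ sh (proj₁ isP) (c ⊙ s) c T c∈G) ⟩
      act sh ((c ⊙ s) ⊙ c) T           ≡⟨ act-cong sh T ((λ _ → refl) , transpose-involutive i j , (λ _ → refl)) ⟩
      act sh s T                       ∎

  χ-composite : ∀ W {h} → Composite sh T h → InIsoGroup sh h × χ W h ≡ false
  χ-composite W none = id-∈G , χ-id W
  χ-composite W (more {g} i j x y pair composite) =
    ⊙-∈G s g (proj₁ s-vanishes) (proj₁ g-vanishes) ,
    trans (χ-⊙ W s g (proj₁ s-vanishes) (proj₁ g-vanishes)) (cong₂ _xor_ (proj₂ s-vanishes) (proj₂ g-vanishes))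
    where
    s = symPairIso sh i j x y
    s-vanishes : InIsoGroup sh s × χ W s ≡ false
    s-vanishes = χ-symPair W pair
    g-vanishes : InIsoGroup sh g × χ W g ≡ false
    g-vanishes = χ-composite W composite

  χ-symmetry : ∀ W g → IsSymmetry sh T g → χ W g ≡ false
  χ-symmetry W g g-sym = ¬-not λ χg≡true →
    let nontrivial : Nontrivial sh g
        nontrivial g≈id = true≢false (trans (sym χg≡true) (trans (χ-cong W {g} {idIso sh} g≈id) (χ-id W)))
        (h , composite , g≈h) = only-pair-symmetries g g-sym nontrivial
    in true≢false (trans (sym χg≡true) (trans (χ-cong W {g} {h} g≈h) (proj₂ (χ-composite W composite))))

  χ-image-invariant : ∀ W g h → InIsoGroup sh g → InIsoGroup sh h → image g ≡ image h → χ W g ≡ χ W h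
  χ-image-invariant W g h g∈G h∈G g≡h =
    xor-cancelʳ (χ W g) (χ W h) (trans (sym (χ-⊙ W g h g∈G h∈G)) (χ-symmetry W (g ⊙ h) (⊙-∈G g h g∈G h∈G , fixes)))
    where
    open ≡-Reasoning
    fixes : image (g ⊙ h) ≡ T
    fixes = begin
      act sh (g ⊙ h) T             ≡⟨ act-∘ sh (proj₁ isP) g h T h∈G ⟩
      act sh h (image g)           ≡⟨ cong (act sh h) g≡h ⟩
      act sh h (image h)           ≡⟨ sym (act-∘ sh (proj₁ isP) h h T h∈G) ⟩
      act sh (h ⊙ h) T             ≡⟨ act-cong sh T (⊙-self h h∈G) ⟩
      image (idIso sh)             ≡⟨ image-id ⟩
      T                            ∎

  private
    others-avoid : ∀ {e es} → All (image e ≢_) (map image es) → All (λ e′ → image e′ ≢ image e) es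
    others-avoid e∉ = All.map (λ e≢e′ e′≡e → e≢e′ (sym e′≡e)) (map⁻ e∉)

  product : (es : List (Iso sh)) → Vec Bool (length es) → Iso sh
  product []       []          = idIso sh
  product (e ∷ es) (true ∷ u)  = e ⊙ product es u
  product (e ∷ es) (false ∷ u) = product es u

  product-∈G : ∀ {es} → All (Elementary sh) es → ∀ u → InIsoGroup sh (product es u)
  product-∈G []                      []          = id-∈G
  product-∈G {e ∷ es} (e-elem ∷ es-elem) (true ∷ u)  =
    ⊙-∈G e (product es u) (elementary-∈G e-elem) (product-∈G es-elem u)
  product-∈G (_ ∷ es-elem)           (false ∷ u) = product-∈G es-elem u

  product-zero : ∀ es → product es (V.replicate (length es) false) ≡ idIso sh
  product-zero []       = refl
  product-zero (_ ∷ es) = product-zero es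

  product-flip : ∀ {es} → All (Elementary sh) es → ∀ l u →
                 product es (V.updateAt u l not) ≈ᵢ (L.lookup es l ⊙ product es u)
  product-flip {e ∷ es} (e-elem ∷ _) zero (true ∷ u) = ⊙-cancelˡ e (product es u) (elementary-∈G e-elem)
  product-flip {e ∷ es} _ zero (false ∷ u) = ≈ᵢ-refl {e ⊙ product es u}
  product-flip {e ∷ es} (e-elem ∷ es-elem) (suc l) (true ∷ u) =
    ≈ᵢ-trans {e ⊙ product es (V.updateAt u l not)} {e ⊙ (eₗ ⊙ product es u)} {eₗ ⊙ (e ⊙ product es u)}
             (⊙-congʳ e {product es (V.updateAt u l not)} {eₗ ⊙ product es u} (product-flip es-elem l u))
             (⊙-left-comm e eₗ (product es u) (elementary-∈G e-elem) (elementary-∈G (All.lookup es-elem (∈-lookup l))))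
    where eₗ = L.lookup es l
  product-flip {e ∷ es} (_ ∷ es-elem) (suc l) (false ∷ u) = product-flip es-elem l u

  χ-product-avoiding : ∀ W {es} → All (Elementary sh) es → All (λ e → image e ≢ W) es → ∀ u → χ W (product es u) ≡ false
  χ-product-avoiding W []                 []              []          = χ-id W
  χ-product-avoiding W {e ∷ es} (e-elem ∷ es-elem) (e↛W ∷ es↛W) (true ∷ u) =
    trans (χ-⊙ W e (product es u) (elementary-∈G e-elem) (product-∈G es-elem u))
          (cong₂ _xor_ (trans (χ-elementary W e-elem) (dec-false (image e ≟ₜ W) e↛W))
                       (χ-product-avoiding W es-elem es↛W u))
  χ-product-avoiding W (_ ∷ es-elem) (_ ∷ es↛W) (false ∷ u) = χ-product-avoiding W es-elem es↛W u

  χ-product-coordinate : ∀ {es} → All (Elementary sh) es → Unique (map image es) →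
                         ∀ l u → χ (image (L.lookup es l)) (product es u) ≡ V.lookup u l
  χ-product-coordinate {e ∷ es} (e-elem ∷ es-elem) (e∉ ∷ _) zero (true ∷ u) =
    trans (χ-⊙ _ e (product es u) (elementary-∈G e-elem) (product-∈G es-elem u))
          (cong₂ _xor_ (trans (χ-elementary _ e-elem) (dec-true (image e ≟ₜ image e) refl))
                       (χ-product-avoiding _ es-elem (others-avoid e∉) u))
  χ-product-coordinate {e ∷ es} (_ ∷ es-elem) (e∉ ∷ _) zero (false ∷ u) =
    χ-product-avoiding _ es-elem (others-avoid e∉) u
  χ-product-coordinate {e ∷ es} (e-elem ∷ es-elem) (e∉ ∷ unique) (suc l) (true ∷ u) =
    trans (χ-⊙ _ e (product es u) (elementary-∈G e-elem) (product-∈G es-elem u))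
          (cong₂ _xor_ (trans (χ-elementary _ e-elem) (dec-false (image e ≟ₜ _) (All.lookup (map⁻ e∉) (∈-lookup l))))
                       (χ-product-coordinate es-elem unique l u))
  χ-product-coordinate {e ∷ es} (_ ∷ es-elem) (_ ∷ unique) (suc l) (false ∷ u) =
    χ-product-coordinate es-elem unique l u

  module Cube (es : List (Iso sh)) (es-elementary : All (Elementary sh) es)
              (images-unique : Unique (map image es))
              (images-complete : ∀ W → Adj sh T W → W ∈ map image es) where

    private
      p∈G : ∀ u → InIsoGroup sh (product es u)
      p∈G = product-∈G es-elementary

      eₗ-elementary : ∀ l → Elementary sh (L.lookup es l)
      eₗ-elementary l = All.lookup es-elementary (∈-lookup l)

      flip : ∀ {d} → Vec Bool d → Fin d → Vec Bool d
      flip u l = V.updateAt u l not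

    vertex : Vec Bool (length es) → Tableau
    vertex u = image (product es u)

    vertex-injective : ∀ u v → vertex u ≡ vertex v → u ≡ v
    vertex-injective u v u≡v = lookup-ext u v λ l → begin
      V.lookup u l              ≡⟨ sym (χ-product-coordinate es-elementary images-unique l u) ⟩
      χ (W l) (product es u)    ≡⟨ χ-image-invariant (W l) _ _ (p∈G u) (p∈G v) u≡v ⟩
      χ (W l) (product es v)    ≡⟨ χ-product-coordinate es-elementary images-unique l v ⟩
      V.lookup v l              ∎
      where
      open ≡-Reasoning
      W : Fin (length es) → Tableau
      W l = image (L.lookup es l)

    act-vertex : ∀ {e} → InIsoGroup sh e → ∀ u → act sh e (vertex u) ≡ act sh (product es u) (image e)
    act-vertex {e} e∈G u = begin
      act sh e (act sh (product es u) T)   ≡⟨ sym (act-∘ sh (proj₁ isP) (product es u) e T e∈G) ⟩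
      act sh (product es u ⊙ e) T          ≡⟨ act-cong sh T (⊙-comm (product es u) e (p∈G u) e∈G) ⟩
      act sh (e ⊙ product es u) T          ≡⟨ act-∘ sh (proj₁ isP) e (product es u) T (p∈G u) ⟩
      act sh (product es u) (image e)      ∎
      where open ≡-Reasoning

    act-vertex-neighbour : ∀ l u → act sh (product es u) (image (L.lookup es l)) ≡ vertex (flip u l)
    act-vertex-neighbour l u = begin
      act sh (product es u) (image eₗ)     ≡⟨ sym (act-∘ sh (proj₁ isP) eₗ (product es u) T (p∈G u)) ⟩
      act sh (eₗ ⊙ product es u) T         ≡⟨ sym (act-cong sh T (product-flip es-elementary l u)) ⟩
      vertex (flip u l)                    ∎
      where
      open ≡-Reasoning
      eₗ = L.lookup es l

    vertex-step : ∀ {e} → Elementary sh e → ∀ u →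
                  act sh e (vertex u) ≡ vertex u ⊎ ∃[ l ] act sh e (vertex u) ≡ vertex (flip u l)
    vertex-step {e} e-elem u = decide (image e ≟ₜ T)
      where
      e·u≡p·e : act sh e (vertex u) ≡ act sh (product es u) (image e)
      e·u≡p·e = act-vertex (elementary-∈G e-elem) u
      decide : Dec (image e ≡ T) → act sh e (vertex u) ≡ vertex u ⊎ ∃[ l ] act sh e (vertex u) ≡ vertex (flip u l)
      decide (yes e-fixes) = inj₁ (trans e·u≡p·e (cong (act sh (product es u)) e-fixes))
      decide (no e-moves)  = inj₂ (Any.index e∈es ,
        trans e·u≡p·e (trans (cong (act sh (product es u)) (Any.lookup-index e∈es)) (act-vertex-neighbour (Any.index e∈es) u)))
        where
        e∈es : Any.Any (λ e′ → image e ≡ image e′) es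
        e∈es = Any.map⁻ (images-complete (image e) ((λ e≡ → e-moves (sym e≡)) , e , e-elem , refl))

    Reaches : Iso sh → Set
    Reaches g = ∃[ u ] image g ≡ vertex u

    reaches-resp : ∀ g h → g ≈ᵢ h → Reaches g → Reaches h
    reaches-resp g h g≈h (u , g↦u) = u , trans (act-cong sh {h} {g} T (≈ᵢ-sym {g} {h} g≈h)) g↦u

    reaches-⊙-elementary : ∀ g {e} → InIsoGroup sh e → Elementary sh e → Reaches g → Reaches (g ⊙ e)
    reaches-⊙-elementary g {e} e∈G e-elem (u , g↦u) =
      [ (λ stays → u , trans g⊙e↦e·u stays) , (λ (l , flips) → flip u l , trans g⊙e↦e·u flips) ]′ (vertex-step e-elem u)
      where
      g⊙e↦e·u : image (g ⊙ e) ≡ act sh e (vertex u)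
      g⊙e↦e·u = trans (act-∘ sh (proj₁ isP) g e T e∈G) (cong (act sh e) g↦u)

    reaches-along : ∀ a ts → All (Swappable a) ts → ∀ g → Reaches g → Reaches (g ⊙ along a (Along.transpositions a ts))
    reaches-along a [] [] g g-reaches = reaches-resp g _ (⊙-along-id g a) g-reaches
    reaches-along a ((i , j) ∷ ts) (ij-swappable ∷ ts-swappable) g g-reaches =
      reaches-resp _ _ (⊙-along-∘ g a (transpose i j) (Along.transpositions a ts))
        (reaches-along a ts ts-swappable (g ⊙ t) (reaches-⊙-elementary g (elementary-∈G t-elem) t-elem g-reaches))
      where
      t = along a (transpose i j)
      t-elem = along-transpose-elementary a i j ij-swappable

    reaches-∈G : ∀ g → InIsoGroup sh g → Reaches g
    reaches-∈G g g∈G =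
      let (tsᵣ , swᵣ , σ≈) = decompose rows
          (ts𝒸 , sw𝒸 , τ≈) = decompose columns
          (tsₛ , swₛ , π≈) = decompose symbols
      in reaches-resp _ g (sym ∘ σ≈ , sym ∘ τ≈ , sym ∘ π≈)
           (reaches-along symbols tsₛ swₛ _ (reaches-along columns ts𝒸 sw𝒸 _ (reaches-along rows tsᵣ swᵣ (idIso sh)
             (V.replicate _ false , cong image (sym (product-zero es))))))
      where
      decompose : ∀ a → ∃[ ts ] All (Swappable a) ts × component a g P.≈ Along.transpositions a ts
      decompose a = Along.preserving⇒transpositions a (component a g) (∈G⇒preserving g g∈G a)

    vertex-surjective : ∀ V → InOrbit sh T V → ∃[ u ] vertex u ≡ V
    vertex-surjective V (g , g∈G , g↦V) = proj₁ g-reaches , trans (sym (proj₂ g-reaches)) g↦V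
      where
      g-reaches : Reaches g
      g-reaches = reaches-∈G g g∈G

    flip-cubeAdj : ∀ (u : Vec Bool (length es)) l → CubeAdj u (flip u l)
    flip-cubeAdj u l = l , (λ u≡flip → not-¬ refl (trans u≡flip (lookup∘updateAt l u)))
                         , (λ k k≢l → sym (lookup∘updateAt′ k l k≢l u))

    adjacent⇒cubeAdj : ∀ u v → Adj sh (vertex u) (vertex v) → CubeAdj u v
    adjacent⇒cubeAdj u v (u≢v , e , e-elem , e↦v) =
      [ (λ stays → ⊥-elim (u≢v (trans (sym stays) e↦v))) ,
        (λ (l , flips) → subst (CubeAdj u) (vertex-injective (flip u l) v (trans (sym flips) e↦v)) (flip-cubeAdj u l)) ]′
      (vertex-step e-elem u)

    cubeAdj⇒adjacent : ∀ u v → CubeAdj u v → Adj sh (vertex u) (vertex v)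
    cubeAdj⇒adjacent u v (l , uₗ≢vₗ , rest-equal) =
      (λ u↦v → uₗ≢vₗ (cong (λ w → V.lookup w l) (vertex-injective u v u↦v))) ,
      L.lookup es l , eₗ-elementary l ,
      trans (act-vertex (elementary-∈G (eₗ-elementary l)) u) (trans (act-vertex-neighbour l u) (cong vertex flip≡v))
      where
      flip≡v : flip u l ≡ v
      flip≡v = lookup-ext (flip u l) v λ k → case k ≟ l of λ where
        (yes refl) → trans (lookup∘updateAt l u) (sym (¬-not (λ vₗ≡uₗ → uₗ≢vₗ (sym vₗ≡uₗ))))
        (no k≢l)   → trans (lookup∘updateAt′ k l k≢l u) (rest-equal k k≢l)

    cube : IsoToCube sh T (length es)
    cube = vertex , (λ {u} {v} → vertex-injective u v) , (λ u → product es u , p∈G u , refl) ,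
           vertex-surjective , λ u v → mk⇔ (adjacent⇒cubeAdj u v) (cubeAdj⇒adjacent u v)

neighbour-transformations : ∀ {sh T} (ns : List Tableau) → (∀ W → W ∈ ns → Adj sh T W) →
                            ∃[ es ] All (Elementary sh) es × map (λ e → act sh e T) es ≡ ns
neighbour-transformations []       _        = [] , [] , refl
neighbour-transformations (W ∷ ns) adjacent =
  let (_ , e , e-elem , e↦W)     = adjacent W (here refl)
      (es , es-elem , es↦ns)     = neighbour-transformations ns (λ W′ → adjacent W′ ∘ there)
  in e ∷ es , e-elem ∷ es-elem , cong₂ _∷_ e↦W es↦ns

lemma5p7 : (sh : Shape) → IsPartition sh → Squareable sh →
           (T : Tableau) → IsLatin sh T →
           (d : ℕ) → (∀ V → InOrbit sh T V → HasDegree sh V d) →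
           (∀ g → IsSymmetry sh T g → Nontrivial sh g → ArisesFromSymPairs sh T g) →
           IsoToCube sh T d
lemma5p7 sh isP sq T latin d regular only-pair-symmetries =
  let (ns , ns-unique , ns-adjacent , ns-length) = regular T (idIso sh , IsotopyGroup.id-∈G sh sq , image-id)
      (es , es-elementary , es↦ns) = neighbour-transformations ns (λ W → Equivalence.to (ns-adjacent W))
      cube = Cube.cube es es-elementary (subst Unique (sym es↦ns) ns-unique)
                       (λ W adj → subst (W ∈_) (sym es↦ns) (Equivalence.from (ns-adjacent W) adj))
  in subst (IsoToCube sh T) (trans (sym (length-map (λ e → act sh e T) es)) (trans (cong length es↦ns) ns-length)) cube
  where open OrbitSignature sh isP sq T latin only-pair-symmetries
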